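{- Let $X$ be a permutation of $[n]$ avoiding $(1,2,\dots,k)$, $T$ an initial tree, and $G(X)=G_T(X)$. For every $i\in\{0,1,\dots,k-1\}$ there are no keys $a<b<c$ and times $t_1<t_2<t_3$ such that $(a,t_1)\in G_i(X)$, $(b,t_2)\in X$ and $(c,t_3)\in G_i(X)$.
   Context: $X=(x_1,\dots,x_n)$ is identified with the point set $\{(x_t,t)\}$. Geometric Greedy $G_T(X)$: the initial BST $T$ is encoded by a fixed point set in rows $-(n-1),\dots,0$ (standard geometric encoding); for $t=1,\dots,n$, with $p=(x_t,t)$ and, for each key $a$, $q=(a,\tau(a,t))$ where $\tau(a,t)$ is the last row $<t$ with a point in column $a$, add $(a,t)$ iff the closed rectangle with corners $p,q$ contains no other point; $G_T(X)$ is the set of points added in rows $1,\dots,n$. A point $p$ dominates $q$ ($p\succ q$) if $p.x>q.x$ and $p.y>q.y$. For $q\in G(X)\setminus X$, $\mathsf{chain}(q)$ is $0$ if no point of $X$ dominates $q$, and otherwise the maximum $j$ such that there are $p_1,\dots,p_j\in X$ with $p_1\succ p_2\succ\dots\succ p_j\succ q$. $G_i(X)=\{q\in G(X)\setminus X:\mathsf{chain}(q)=i\}$. -}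

module Defs where

open import Data.Bool using (Bool; true; false; _∧_; _∨_; not)
open import Data.Nat as ℕ using (ℕ; zero; suc; _⊔_; _⊓_)
open import Data.Integer as ℤ using (ℤ; +_; -_)
open import Data.Maybe using (Maybe; just; nothing)
open import Data.Product using (_×_; _,_; proj₁; proj₂; Σ; Σ-syntax)
open import Data.List using (List; []; _∷_; _++_; map; upTo; length; [_]; filter)
open import Data.List.Membership.Propositional using (_∈_)
open import Data.List.Relation.Unary.All using (All)
open import Data.List.Relation.Unary.Linked using (Linked)
open import Data.List.Relation.Binary.Sublist.Propositional using (_⊆_)
open import Data.List.Relation.Binary.Permutation.Propositional using (_↭_)
open import Relation.Nullary using (¬_)
open import Relation.Nullary.Decidable using (⌊_⌋)
open import Relation.Binary.PropositionalEquality using (_≡_; _≢_)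

-- Points of the plane: (key / column, time / row).  Keys are naturals
-- (the key set is [n] = {1,…,n}); rows are integers, since the initial
-- tree occupies rows -(n-1),…,0.

Point : Set
Point = ℕ × ℤ

keys : ℕ → List ℕ
keys n = map suc (upTo n)

data Tree : Set where
  leaf : Tree
  node : Tree → ℕ → Tree → Tree

inorder : Tree → List ℕ
inorder leaf         = []
inorder (node l k r) = inorder l ++ (k ∷ inorder r)

-- T is an initial tree on [n]: a BST whose key set is [n]
-- (equivalently its in-order traversal is 1,2,…,n).
IsInitialTree : ℕ → Tree → Set
IsInitialTree n T = inorder T ≡ keys n

-- Standard geometric encoding: key a at depth d (root has depth 0) is
-- the point (a , -d); so the tree occupies rows -(n-1),…,0, the root in row 0.
encodeAt : ℕ → Tree → List Point
encodeAt d leaf         = []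
encodeAt d (node l k r) = (k , - (+ d)) ∷ (encodeAt (suc d) l ++ encodeAt (suc d) r)

encode : Tree → List Point
encode = encodeAt 0

allB : {A : Set} → (A → Bool) → List A → Bool
allB f []       = true
allB f (x ∷ xs) = f x ∧ allB f xs

lastRow : List Point → ℕ → Maybe ℤ
lastRow []             a = nothing
lastRow ((b , s) ∷ S) a with lastRow S a | ⌊ b ℕ.≟ a ⌋
... | m        | false = m
... | nothing  | true  = just s
... | just s′  | true  = just (s ℤ.⊔ s′)

_≟P_ : Point → Point → Bool
(a , s) ≟P (b , t) = ⌊ a ℕ.≟ b ⌋ ∧ ⌊ s ℤ.≟ t ⌋

inRect : Point → Point → Point → Bool
inRect (px , py) (qx , qy) (rx , ry) =
  ⌊ (px ⊓ qx) ℕ.≤? rx ⌋ ∧ ⌊ rx ℕ.≤? (px ⊔ qx) ⌋ ∧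
  ⌊ (py ℤ.⊓ qy) ℤ.≤? ry ⌋ ∧ ⌊ ry ℤ.≤? (py ℤ.⊔ qy) ⌋

-- S : all points in rows < t;  p = (x , t) the access in row t.
-- (a , t) is added iff the closed rectangle with corners p and
-- q = (a , τ(a,t)) contains no point other than p and q.
-- (All points of S lie in rows < t, so none of them equals p.)
addsAt : List Point → ℤ → ℕ → ℕ → Bool
addsAt S t x a with lastRow S a
... | nothing = false
... | just τ  = allB (λ r → not (not (r ≟P (a , τ)) ∧ inRect (x , t) (a , τ) r)) S

greedyRow : List Point → ℤ → ℕ → List ℕ → List Point
greedyRow S t x ks = map (λ a → (a , t)) (filter (λ a → addsAt S t x a ≡? true) ks)
  where
  open import Data.Bool.Properties using () renaming (_≟_ to _≡?_)

-- greedyFrom n S t xs : the points added in rows t, t+1, … when the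
-- remaining access sequence is xs and S is the set of points in rows < t.
greedyFrom : ℕ → List Point → ℤ → List ℕ → List Point
greedyFrom n S t []       = []
greedyFrom n S t (x ∷ xs) =
  greedyRow S t x (keys n) ++ greedyFrom n (S ++ greedyRow S t x (keys n)) (t ℤ.+ + 1) xs

G : ℕ → Tree → List ℕ → List Point
G n T xs = greedyFrom n (encode T) (+ 1) xs

pointsFrom : ℤ → List ℕ → List Point
pointsFrom t []       = []
pointsFrom t (x ∷ xs) = (x , t) ∷ pointsFrom (t ℤ.+ + 1) xs

Xpts : List ℕ → List Point
Xpts = pointsFrom (+ 1)

IsPermutation : ℕ → List ℕ → Set
IsPermutation n xs = xs ↭ keys n

-- X avoids (1,2,…,k): no subsequence of X is order-isomorphic to
-- (1,2,…,k), i.e. X has no strictly increasing subsequence of length k.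
Avoids12k : ℕ → List ℕ → Set
Avoids12k k xs = ∀ ys → ys ⊆ xs → Linked ℕ._<_ ys → length ys ≢ k

_≻_ : Point → Point → Set
p ≻ q = (proj₁ q ℕ.< proj₁ p) × (proj₂ q ℤ.< proj₂ p)

IsChain : List Point → Point → List Point → Set
IsChain Xs q ps = All (_∈ Xs) ps × Linked _≻_ (ps ++ [ q ])

-- chain(q) = i : i is the maximum length of such a chain
-- (for i = 0 this says that no point of X dominates q)
ChainIs : List Point → Point → ℕ → Set
ChainIs Xs q i =
  (Σ[ ps ∈ List Point ] (IsChain Xs q ps × length ps ≡ i)) ×
  (∀ ps → IsChain Xs q ps → length ps ℕ.≤ i)

InGi : ℕ → Tree → List ℕ → ℕ → Point → Set
InGi n T xs i q = q ∈ G n T xs × ¬ (q ∈ Xpts xs) × ChainIs (Xpts xs) q i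

-- If (b , t₂) ∈ X lies strictly between (a , t₁) and (c , t₃) in both coordinates, then
-- every X-chain dominating (c , t₃) continues through (b , t₂) down to (a , t₁), so
-- chain(a , t₁) > chain(c , t₃).  Hence the two points cannot share the same level i.
module Submission where

open import Defs
open import Data.Nat using (ℕ)
open import Data.List using (List)
open import Data.Product using (_×_; _,_; ∃-syntax)
open import Data.List.Membership.Propositional using (_∈_)
open import Relation.Nullary using (¬_)
import Data.Nat as N
import Data.Integer as Z

open import Data.List using ([]; _∷_; _∷ʳ_; length)
open import Data.List.Properties using (length-++)
open import Data.List.Relation.Unary.All using (_∷_; [])
open import Data.List.Relation.Unary.All.Properties using (++⁺)
open import Data.List.Relation.Unary.Linked using (Linked; []; [-]; _∷_)
open import Data.Nat.Properties using (<-irrefl; ≤-trans; ≤-reflexive; +-comm; <-trans)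
import Data.Integer.Properties as ZP
open import Relation.Binary.Core using (Rel)
open import Relation.Binary.Definitions using (Transitive)
open import Relation.Binary.PropositionalEquality using (_≡_; refl; sym; trans)

module _ {a ℓ} {A : Set a} {R : Rel A ℓ} where

  Linked-∷ʳ-weaken : Transitive R → ∀ xs {y z} →
                     Linked R (xs ∷ʳ y) → R y z → Linked R (xs ∷ʳ z)
  Linked-∷ʳ-weaken R-trans []           _            Ryz = [-]
  Linked-∷ʳ-weaken R-trans (x ∷ [])     (Rxy ∷ [-])  Ryz = R-trans Rxy Ryz ∷ [-]
  Linked-∷ʳ-weaken R-trans (x ∷ x′ ∷ xs) (Rxx′ ∷ Rs) Ryz =
    Rxx′ ∷ Linked-∷ʳ-weaken R-trans (x′ ∷ xs) Rs Ryz

  Linked-∷ʳ⁺ : ∀ xs {y z} → Linked R (xs ∷ʳ y) → R y z → Linked R (xs ∷ʳ y ∷ʳ z)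
  Linked-∷ʳ⁺ []            _           Ryz = Ryz ∷ [-]
  Linked-∷ʳ⁺ (x ∷ [])      (Rxy ∷ [-]) Ryz = Rxy ∷ Ryz ∷ [-]
  Linked-∷ʳ⁺ (x ∷ x′ ∷ xs) (Rxx′ ∷ Rs) Ryz = Rxx′ ∷ Linked-∷ʳ⁺ (x′ ∷ xs) Rs Ryz

≻-trans : Transitive _≻_
≻-trans (a<b , s<t) (c<a , u<s) = <-trans c<a a<b , ZP.<-trans u<s s<t

IsChain-∷ʳ : ∀ {Xs p q r} ps → IsChain Xs q ps → q ≻ p → p ∈ Xs → p ≻ r →
             IsChain Xs r (ps ∷ʳ p)
IsChain-∷ʳ ps (ps∈Xs , linked) q≻p p∈Xs p≻r =
  ++⁺ ps∈Xs (p∈Xs ∷ []) ,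
  Linked-∷ʳ⁺ ps (Linked-∷ʳ-weaken ≻-trans ps linked q≻p) p≻r

ChainIs-< : ∀ {Xs p q r i j} → ChainIs Xs q i → ChainIs Xs r j →
            q ≻ p → p ∈ Xs → p ≻ r → i N.< j
ChainIs-< ((ps , chain , refl) , _) (_ , maximal) q≻p p∈Xs p≻r =
  ≤-trans (≤-reflexive (sym length-∷ʳ)) (maximal (ps ∷ʳ _) (IsChain-∷ʳ ps chain q≻p p∈Xs p≻r))
  where
  length-∷ʳ : length (ps ∷ʳ _) ≡ N.suc (length ps)
  length-∷ʳ = trans (length-++ ps) (+-comm (length ps) 1)

mainTheorem14 : (n k : ℕ) (xs : List ℕ) (T : Tree) →
    IsPermutation n xs → Avoids12k k xs → IsInitialTree n T →
    (i : ℕ) → i N.< k →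
    ¬ (∃[ a ] ∃[ b ] ∃[ c ] ∃[ t₁ ] ∃[ t₂ ] ∃[ t₃ ]
         ((a N.< b) × (b N.< c) × (t₁ Z.< t₂) × (t₂ Z.< t₃) ×
          InGi n T xs i (a , t₁) × ((b , t₂) ∈ Xpts xs) × InGi n T xs i (c , t₃)))
mainTheorem14 n k xs T _ _ _ i _
  (a , b , c , t₁ , t₂ , t₃ , a<b , b<c , t₁<t₂ , t₂<t₃ ,
   (_ , _ , chainA) , b∈X , (_ , _ , chainC)) =
  <-irrefl refl (ChainIs-< chainC chainA (b<c , t₂<t₃) b∈X (a<b , t₁<t₂))
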